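{- For $n\ge 3$, $\chi(\mathsf{FC}_2(n))=3$ when $n$ is odd and $\chi(\mathsf{FC}_2(n))=2$ when $n$ is even. For $d\ge 3$ and $n\ge d+1$, $\chi(\mathsf{FC}_d(n))=2$.
   Context: A proper coloring of a hypergraph $(V,\mathcal{E})$ is a coloring of $V$ such that every hyperedge $e$ with $|e|\ge 2$ contains two vertices of different colors; $\chi(H)$ is the least number of colors in a proper coloring. For $n\ge d+1$ (or $n\ge 3$ when $d=2$), $\mathsf{C}_d(n)$ is the convex hull of $\gamma_d(1),\dots,\gamma_d(n)$ where $\gamma_d(t)=(t,t^2,\dots,t^d)$, and we identify $\gamma_d(i)$ with $i\in[n]$. $\mathsf{FC}_d(n)$ is the $d$-uniform hypergraph on $[n]$ whose hyperedges are the vertex sets of facets of $\mathsf{C}_d(n)$. Equivalently (Gale's evenness criterion), a $d$-subset $S\subseteq[n]$ is a hyperedge iff for all $i,j\in[n]\setminus S$ the set $\{k\in S: i<k<j\}$ has even size. -}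

module Defs where

open import Data.Nat using (ℕ; _≤_)
open import Data.Nat.Divisibility using (_∣_)
open import Data.Fin using (Fin; _<_)
open import Data.Fin.Properties using (_<?_)
open import Data.Fin.Subset using (Subset; _∈_; _∉_; _∩_; ∣_∣)
open import Data.Bool using (_∧_)
open import Data.Vec using (tabulate)
open import Data.Product using (Σ; _×_; ∃)
open import Relation.Nullary using (¬_; does)
open import Relation.Binary.PropositionalEquality using (_≢_)

-- A hypergraph on the vertex set Fin n (vertex i ∈ Fin n stands for i+1 ∈ [n],
-- the order being preserved), given by the predicate "is a hyperedge".
Hypergraph : ℕ → Set₁
Hypergraph n = Subset n → Set

ProperColoring : {n k : ℕ} → Hypergraph n → (Fin n → Fin k) → Set
ProperColoring {n} H c =
  ∀ (e : Subset n) → H e → 2 ≤ ∣ e ∣ →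
  ∃ λ (x : Fin n) → ∃ λ (y : Fin n) → x ∈ e × y ∈ e × c x ≢ c y

Colorable : {n : ℕ} → Hypergraph n → ℕ → Set
Colorable {n} H k = Σ (Fin n → Fin k) (ProperColoring H)

ChromaticNumberIs : {n : ℕ} → Hypergraph n → ℕ → Set
ChromaticNumberIs H m = Colorable H m × (∀ k → k Data.Nat.< m → ¬ Colorable H k)

between : {n : ℕ} → Fin n → Fin n → Subset n
between i j = tabulate (λ k → does (i <? k) ∧ does (k <? j))

-- Hyperedges of FC_d(n), via Gale's evenness criterion: d-subsets S such
-- that for all i, j ∉ S, |{k ∈ S : i < k < j}| is even.
FC : (d n : ℕ) → Hypergraph n
FC d n S = (∣ S ∣ Relation.Binary.PropositionalEquality.≡ d) ×
           (∀ (i j : Fin n) → i ∉ S → j ∉ S → 2 ∣ ∣ S ∩ between i j ∣)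

{-# OPTIONS --safe #-}
-- A vertex whose two neighbours lie outside a set S satisfying Gale's evenness condition would be
-- the only element of S strictly between them; so an edge of FC_d(n) that contains no two
-- consecutive vertices lies inside the pair of ends {1, n}.  A colouring that alternates along the
-- path 1, 2, …, n (parity) hence leaves no edge of size d ≥ 3 monochromatic, and for d = 2 it is
-- proper as soon as it also separates 1 and n, i.e. properly colours the n-cycle: parity does so
-- for n even, and parity with n recoloured by a third colour for n odd.  Conversely the pairs
-- {i, i+1} and {1, n} are edges of FC_2(n), so its proper colourings properly colour the n-cycle,
-- which needs three colours when n is odd.  Finally {1, …, d} is an edge, so one colour never
-- suffices.

module Submission where

open import Defs
open import Data.Nat using (ℕ; _≤_; _+_)
open import Data.Nat.Divisibility using (_∣_; divides; ∣-refl; _∣0; ∣m∣n⇒∣m+n; >⇒∤)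
open import Data.Product using (_×_; _,_; ∃₂; proj₁; proj₂)
open import Relation.Nullary using (¬_; yes; no; contradiction; ¬?; proof)

open import Data.Bool using (true; false)
open import Data.Empty using (⊥-elim)
open import Data.Fin using (Fin; zero; suc; toℕ; fromℕ; inject₁; inject≤; _<_)
open import Data.Fin.Properties
  using (toℕ-injective; toℕ-inject₁; toℕ-fromℕ; ≤fromℕ; inject₁-injective; inject≤-injective;
         fromℕ≢inject₁; any?; _<?_)
  renaming (_≟_ to _≟ᶠ_)
open import Data.Fin.Relation.Unary.Top using (view; ‵fromℕ; ‵inject₁; view-fromℕ)
open import Data.Fin.Subset using (Subset; _∈_; _∉_; _∩_; _∪_; _⊆_; ⁅_⁆; ∣_∣; ⊥; Empty)
open import Data.Fin.Subset.Properties
  using (_∈?_; ∉⊥; ∣⊥∣≡0; Empty-unique; x∈⁅x⁆; x∈⁅y⁆⇒x≡y; x≢y⇒x∉⁅y⁆; ∣⁅x⁆∣≡1; ⊆-antisym; ⊆-trans;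
         ⊆-reflexive; p⊆q⇒∣p∣≤∣q∣; p⊂q⇒∣p∣<∣q∣; p∩q⊆p; x∈p∩q⁺; x∈p∩q⁻; x∈p∪q⁺; x∈p∪q⁻;
         p⊆p∪q; ∪-comm)
import Data.Nat as ℕ
import Data.Nat.Properties as ℕ
open import Data.Sum using (_⊎_; inj₁; inj₂; [_,_]′)
import Data.Sum as Sum
open import Data.Vec using ([]; _∷_; here; there)
open import Data.Vec.Properties using (lookup∘tabulate; []=⇒lookup; lookup⇒[]=)
open import Function using (_∘_; _⇔_; mk⇔; Equivalence)
open import Relation.Nullary.Decidable using (_×-dec_; dec-true; decidable-stable)
open import Relation.Nullary.Reflects using (Reflects; invert)
open import Relation.Binary.PropositionalEquality

private
  variable
    d k l m n : ℕ
    a b i j p q s x y : Fin n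

∣Empty∣≡0 : {S : Subset n} → Empty S → ∣ S ∣ ≡ 0
∣Empty∣≡0 {n} S-empty = trans (cong ∣_∣ (Empty-unique S-empty)) (∣⊥∣≡0 n)

∣p∪q∣≤∣p∣+∣q∣ : (S T : Subset n) → ∣ S ∪ T ∣ ≤ ∣ S ∣ + ∣ T ∣
∣p∪q∣≤∣p∣+∣q∣ []            []            = ℕ.z≤n
∣p∪q∣≤∣p∣+∣q∣ (true  ∷ S)   (true  ∷ T)   =
  ℕ.s≤s (ℕ.≤-trans (∣p∪q∣≤∣p∣+∣q∣ S T) (ℕ.+-monoʳ-≤ ∣ S ∣ (ℕ.n≤1+n ∣ T ∣)))
∣p∪q∣≤∣p∣+∣q∣ (true  ∷ S)   (false ∷ T)   = ℕ.s≤s (∣p∪q∣≤∣p∣+∣q∣ S T)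
∣p∪q∣≤∣p∣+∣q∣ (false ∷ S)   (true  ∷ T)   =
  ℕ.≤-trans (ℕ.s≤s (∣p∪q∣≤∣p∣+∣q∣ S T)) (ℕ.≤-reflexive (sym (ℕ.+-suc ∣ S ∣ ∣ T ∣)))
∣p∪q∣≤∣p∣+∣q∣ (false ∷ S)   (false ∷ T)   = ∣p∪q∣≤∣p∣+∣q∣ S T

pair : Fin n → Fin n → Subset n
pair a b = ⁅ a ⁆ ∪ ⁅ b ⁆

∈-pair⁻ : x ∈ pair a b → x ≡ a ⊎ x ≡ b
∈-pair⁻ {a = a} {b} = Sum.map (x∈⁅y⁆⇒x≡y a) (x∈⁅y⁆⇒x≡y b) ∘ x∈p∪q⁻ ⁅ a ⁆ ⁅ b ⁆

a∈pair : (a b : Fin n) → a ∈ pair a b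
a∈pair a _ = x∈p∪q⁺ (inj₁ (x∈⁅x⁆ a))

b∈pair : (a b : Fin n) → b ∈ pair a b
b∈pair _ b = x∈p∪q⁺ (inj₂ (x∈⁅x⁆ b))

pair⊆ : {S : Subset n} → a ∈ S → b ∈ S → pair a b ⊆ S
pair⊆ {S = S} a∈S b∈S x∈ =
  [ (λ x≡a → subst (_∈ S) (sym x≡a) a∈S) , (λ x≡b → subst (_∈ S) (sym x≡b) b∈S) ]′ (∈-pair⁻ x∈)

∣pair∣≤2 : (a b : Fin n) → ∣ pair a b ∣ ≤ 2
∣pair∣≤2 a b =
  ℕ.≤-trans (∣p∪q∣≤∣p∣+∣q∣ ⁅ a ⁆ ⁅ b ⁆) (ℕ.≤-reflexive (cong₂ _+_ (∣⁅x⁆∣≡1 a) (∣⁅x⁆∣≡1 b)))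

∣pair∣≡2 : a ≢ b → ∣ pair a b ∣ ≡ 2
∣pair∣≡2 {a = a} {b} a≢b = ℕ.≤-antisym (∣pair∣≤2 a b) 2≤∣pair∣
  where
  2≤∣pair∣ : 2 ≤ ∣ pair a b ∣
  2≤∣pair∣ = subst (λ k → ℕ.suc k ≤ ∣ pair a b ∣) (∣⁅x⁆∣≡1 a)
               (p⊂q⇒∣p∣<∣q∣ (p⊆p∪q ⁅ b ⁆ , b , b∈pair a b , x≢y⇒x∉⁅y⁆ (a≢b ∘ sym)))

∣pair∩∣-even : {B : Subset n} → a ≢ b → (a ∈ B ⇔ b ∈ B) → 2 ∣ ∣ pair a b ∩ B ∣
∣pair∩∣-even {a = a} {b} {B} a≢b a⇔b with a ∈? B
... | yes a∈B = subst (2 ∣_) (sym (trans (cong ∣_∣ pair∩B≡pair) (∣pair∣≡2 a≢b))) ∣-refl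
  where
  pair∩B≡pair : pair a b ∩ B ≡ pair a b
  pair∩B≡pair = ⊆-antisym (p∩q⊆p _ _) (λ x∈ → x∈p∩q⁺ (x∈ , pair⊆ a∈B (Equivalence.to a⇔b a∈B) x∈))
... | no a∉B = subst (2 ∣_) (sym (∣Empty∣≡0 pair∩B-empty)) (2 ∣0)
  where
  pair∩B-empty : Empty (pair a b ∩ B)
  pair∩B-empty (x , x∈) with x∈p∩q⁻ (pair a b) B x∈
  ... | x∈pair , x∈B = a∉B ([ (λ x≡a → subst (_∈ B) x≡a x∈B)
                              , (λ x≡b → Equivalence.from a⇔b (subst (_∈ B) x≡b x∈B)) ]′ (∈-pair⁻ x∈pair))

⊆pair⇒both∈ : {S : Subset n} → S ⊆ pair a b → 2 ≤ ∣ S ∣ → a ∈ S × b ∈ S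
⊆pair⇒both∈ {a = a} {b} {S} S⊆ab 2≤∣S∣ =
  first∈ S⊆ab , first∈ (⊆-trans S⊆ab (⊆-reflexive (∪-comm ⁅ a ⁆ ⁅ b ⁆)))
  where
  first∈ : ∀ {a b} → S ⊆ pair a b → a ∈ S
  first∈ {a} {b} S⊆ab with a ∈? S
  ... | yes a∈S = a∈S
  ... | no a∉S = contradiction (ℕ.≤-trans 2≤∣S∣ ∣S∣≤1) λ { (ℕ.s≤s ()) }
    where
    S⊆⁅b⁆ : S ⊆ ⁅ b ⁆
    S⊆⁅b⁆ x∈S with ∈-pair⁻ (S⊆ab x∈S)
    ... | inj₁ refl = contradiction x∈S a∉S
    ... | inj₂ refl = x∈⁅x⁆ b
    ∣S∣≤1 : ∣ S ∣ ≤ 1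
    ∣S∣≤1 = ℕ.≤-trans (p⊆q⇒∣p∣≤∣q∣ S⊆⁅b⁆) (ℕ.≤-reflexive (∣⁅x⁆∣≡1 b))

∈-between⁺ : i < x → x < j → x ∈ between i j
∈-between⁺ {i = i} {x = x} {j = j} i<x x<j =
  lookup⇒[]= x _ (trans (lookup∘tabulate _ x) (dec-true ((i <? x) ×-dec (x <? j)) (i<x , x<j)))

∈-between⁻ : x ∈ between i j → i < x × x < j
∈-between⁻ {x = x} {i = i} {j = j} x∈ =
  invert (subst (Reflects _) (trans (sym (lookup∘tabulate _ x)) ([]=⇒lookup x∈))
                (proof ((i <? x) ×-dec (x <? j))))

Consecutive : Fin n → Fin n → Set
Consecutive x y = ℕ.suc (toℕ x) ≡ toℕ y

consecutive⇒≢ : Consecutive x y → x ≢ y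
consecutive⇒≢ x→y x≡y = ℕ.1+n≢n (trans x→y (cong toℕ (sym x≡y)))

inject₁-suc-consecutive : (x : Fin n) → Consecutive (inject₁ x) (suc x)
inject₁-suc-consecutive x = cong ℕ.suc (toℕ-inject₁ x)

inject₁-consecutive : Consecutive x y → Consecutive (inject₁ x) (inject₁ y)
inject₁-consecutive {x = x} {y} x→y rewrite toℕ-inject₁ x | toℕ-inject₁ y = x→y

fromℕ≮ : {y : Fin (ℕ.suc m)} → ¬ fromℕ m < y
fromℕ≮ {y = y} last<y = ℕ.<⇒≱ last<y (≤fromℕ y)

end-or-interior : (s : Fin (ℕ.suc m)) →
  s ≡ zero ⊎ s ≡ fromℕ m ⊎ ∃₂ λ p q → Consecutive p s × Consecutive s q
end-or-interior s with view s
... | ‵fromℕ           = inj₂ (inj₁ refl)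
... | ‵inject₁ zero    = inj₁ refl
... | ‵inject₁ (suc t) = inj₂ (inj₂ (inject₁ (inject₁ t) , suc (suc t) ,
                                     inject₁-suc-consecutive (inject₁ t) , inject₁-suc-consecutive (suc t)))

between-consecutive : Consecutive p s → Consecutive s q → x ∈ between p q → x ≡ s
between-consecutive {p = p} {s} {q} {x} p→s s→q x∈ with ∈-between⁻ x∈
... | p<x , x<q = toℕ-injective (ℕ.≤-antisym x≤s s≤x)
  where
  x≤s : toℕ x ≤ toℕ s
  x≤s = ℕ.s≤s⁻¹ (subst (ℕ.suc (toℕ x) ≤_) (sym s→q) x<q)
  s≤x : toℕ s ≤ toℕ x
  s≤x = subst (_≤ toℕ x) p→s p<x

consecutive-∈-between⇔ : Consecutive a b → i ≢ a → j ≢ b → (a ∈ between i j ⇔ b ∈ between i j)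
consecutive-∈-between⇔ {a = a} {b} {i} {j} a→b i≢a j≢b = mk⇔ a∈⇒b∈ b∈⇒a∈
  where
  a<b : a < b
  a<b = ℕ.≤-reflexive a→b
  a∈⇒b∈ : a ∈ between i j → b ∈ between i j
  a∈⇒b∈ a∈ with ∈-between⁻ {i = i} {j = j} a∈
  ... | i<a , a<j = ∈-between⁺ (ℕ.<-trans i<a a<b)
                               (ℕ.≤∧≢⇒< (subst (_≤ toℕ j) a→b a<j) (j≢b ∘ toℕ-injective ∘ sym))
  b∈⇒a∈ : b ∈ between i j → a ∈ between i j
  b∈⇒a∈ b∈ with ∈-between⁻ {i = i} {j = j} b∈
  ... | i<b , b<j = ∈-between⁺ (ℕ.≤∧≢⇒< (ℕ.s≤s⁻¹ (subst (ℕ.suc (toℕ i) ≤_) (sym a→b) i<b))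
                                         (i≢a ∘ toℕ-injective))
                               (ℕ.<-trans a<b b<j)

GaleEvenness : Subset n → Set
GaleEvenness {n} S = ∀ (i j : Fin n) → i ∉ S → j ∉ S → 2 ∣ ∣ S ∩ between i j ∣

GaleEvenness-¬isolated : ∀ {S : Subset n} {p s q} → GaleEvenness S →
  Consecutive p s → Consecutive s q → p ∉ S → q ∉ S → s ∉ S
GaleEvenness-¬isolated {S = S} {p} {s} {q} gale p→s s→q p∉S q∉S s∈S =
  >⇒∤ ℕ.≤-refl (subst (2 ∣_) (trans (cong ∣_∣ S∩between≡⁅s⁆) (∣⁅x⁆∣≡1 s)) (gale p q p∉S q∉S))
  where
  S∩between≡⁅s⁆ : S ∩ between p q ≡ ⁅ s ⁆
  S∩between≡⁅s⁆ = ⊆-antisym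
    (λ x∈ → subst (_∈ ⁅ s ⁆) (sym (between-consecutive p→s s→q (proj₂ (x∈p∩q⁻ S _ x∈)))) (x∈⁅x⁆ s))
    (λ x∈⁅s⁆ → subst (_∈ S ∩ between p q) (sym (x∈⁅y⁆⇒x≡y s x∈⁅s⁆))
                     (x∈p∩q⁺ (s∈S , ∈-between⁺ (ℕ.≤-reflexive p→s) (ℕ.≤-reflexive s→q))))

downClosed⇒GaleEvenness : {S : Subset n} → (∀ {x y} → y ∈ S → x < y → x ∈ S) → GaleEvenness S
downClosed⇒GaleEvenness {S = S} closed i j i∉S _ = subst (2 ∣_) (sym (∣Empty∣≡0 S∩between-empty)) (2 ∣0)
  where
  S∩between-empty : Empty (S ∩ between i j)
  S∩between-empty (x , x∈) with x∈p∩q⁻ S _ x∈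
  ... | x∈S , x∈between = i∉S (closed x∈S (proj₁ (∈-between⁻ {i = i} {j = j} x∈between)))

FC₂-pair : a ≢ b →
  (∀ {i j} → i ∉ pair a b → j ∉ pair a b → a ∈ between i j ⇔ b ∈ between i j) →
  FC 2 n (pair a b)
FC₂-pair a≢b a⇔b = ∣pair∣≡2 a≢b , λ i j i∉ j∉ → ∣pair∩∣-even a≢b (a⇔b i∉ j∉)

FC₂-consecutive : Consecutive a b → FC 2 n (pair a b)
FC₂-consecutive {a = a} {b = b} a→b = FC₂-pair (consecutive⇒≢ a→b) λ i∉ j∉ →
  consecutive-∈-between⇔ a→b (λ i≡a → i∉ (subst (_∈ pair a b) (sym i≡a) (a∈pair a b)))
                             (λ j≡b → j∉ (subst (_∈ pair a b) (sym j≡b) (b∈pair a b)))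

FC₂-ends : FC 2 (ℕ.suc (ℕ.suc m)) (pair zero (fromℕ (ℕ.suc m)))
FC₂-ends {m = m} = FC₂-pair {a = zero} {b = fromℕ (ℕ.suc m)} (λ ()) λ {i} {j} _ _ →
  mk⇔ (λ zero∈ → contradiction (proj₁ (∈-between⁻ {i = i} {j = j} zero∈)) ℕ.n≮0)
      (λ last∈ → contradiction (proj₂ (∈-between⁻ {i = i} {j = j} last∈)) fromℕ≮)

Monochromatic : (Fin n → Fin k) → Subset n → Set
Monochromatic c S = ∀ {x y} → x ∈ S → y ∈ S → c x ≡ c y

Alternating : (Fin n → Fin k) → Set
Alternating c = ∀ {x y} → Consecutive x y → c x ≢ c y

properColoring⇒¬monochromatic : {H : Hypergraph n} {c : Fin n → Fin k} {e : Subset n} →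
  ProperColoring H c → H e → 2 ≤ ∣ e ∣ → ¬ Monochromatic c e
properColoring⇒¬monochromatic proper He 2≤∣e∣ mono with proper _ He 2≤∣e∣
... | _ , _ , x∈ , y∈ , cx≢cy = cx≢cy (mono x∈ y∈)

¬monochromatic⇒properColoring : {H : Hypergraph n} {c : Fin n → Fin k} →
  (∀ e → H e → 2 ≤ ∣ e ∣ → ¬ Monochromatic c e) → ProperColoring H c
¬monochromatic⇒properColoring {c = c} ¬mono e He 2≤∣e∣
  with any? (λ x → any? λ y → (x ∈? e) ×-dec (y ∈? e) ×-dec ¬? (c x ≟ᶠ c y))
... | yes split = split
... | no ¬split = ⊥-elim (¬mono e He 2≤∣e∣ mono)
  where
  mono : Monochromatic c e
  mono {x} {y} x∈ y∈ = decidable-stable (c x ≟ᶠ c y) λ cx≢cy → ¬split (x , y , x∈ , y∈ , cx≢cy)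

FC-properColoring⇒¬monochromatic : {c : Fin n → Fin k} {e : Subset n} →
  2 ≤ d → ProperColoring (FC d n) c → FC d n e → ¬ Monochromatic c e
FC-properColoring⇒¬monochromatic 2≤d proper edge@(∣e∣≡d , _) =
  properColoring⇒¬monochromatic proper edge (subst (2 ≤_) (sym ∣e∣≡d) 2≤d)

pair-monochromatic : {c : Fin n → Fin k} → c a ≡ c b → Monochromatic c (pair a b)
pair-monochromatic {a = a} {b = b} {c = c} ca≡cb x∈ y∈ = trans (colour x∈) (sym (colour y∈))
  where
  colour : ∀ {x} → x ∈ pair a b → c x ≡ c a
  colour x∈ = [ cong c , (λ x≡b → trans (cong c x≡b) (sym ca≡cb)) ]′ (∈-pair⁻ x∈)

monochromatic-⊆-ends : {c : Fin (ℕ.suc m) → Fin k} {S : Subset (ℕ.suc m)} →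
  Alternating c → GaleEvenness S → Monochromatic c S → S ⊆ pair zero (fromℕ m)
monochromatic-⊆-ends {m = m} alt gale mono {s} s∈S with end-or-interior s
... | inj₁ refl                        = a∈pair zero (fromℕ m)
... | inj₂ (inj₁ refl)                 = b∈pair zero (fromℕ m)
... | inj₂ (inj₂ (p , q , p→s , s→q)) = contradiction s∈S
  (GaleEvenness-¬isolated gale p→s s→q (λ p∈S → alt p→s (mono p∈S s∈S)) (λ q∈S → alt s→q (mono s∈S q∈S)))

alternating⇒properColoring : {c : Fin (ℕ.suc m) → Fin k} →
  3 ≤ d → Alternating c → ProperColoring (FC d (ℕ.suc m)) c
alternating⇒properColoring {m = m} 3≤d alt = ¬monochromatic⇒properColoring λ e (∣e∣≡d , gale) _ mono →
  ℕ.<⇒≱ (subst (2 ℕ.<_) (sym ∣e∣≡d) 3≤d)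
        (ℕ.≤-trans (p⊆q⇒∣p∣≤∣q∣ (monochromatic-⊆-ends alt gale mono)) (∣pair∣≤2 zero (fromℕ m)))

cycleColoring⇒properColoring₂ : {c : Fin (ℕ.suc m) → Fin k} →
  Alternating c → c zero ≢ c (fromℕ m) → ProperColoring (FC 2 (ℕ.suc m)) c
cycleColoring⇒properColoring₂ alt ends≢ = ¬monochromatic⇒properColoring λ e (_ , gale) 2≤∣e∣ mono →
  let zero∈e , last∈e = ⊆pair⇒both∈ (monochromatic-⊆-ends alt gale mono) 2≤∣e∣
  in ends≢ (mono zero∈e last∈e)

FC₂-properColoring⇒alternating : {c : Fin n → Fin k} → ProperColoring (FC 2 n) c → Alternating c
FC₂-properColoring⇒alternating proper a→b ca≡cb =
  FC-properColoring⇒¬monochromatic ℕ.≤-refl proper (FC₂-consecutive a→b) (pair-monochromatic ca≡cb)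

FC₂-properColoring⇒ends≢ : {c : Fin (ℕ.suc (ℕ.suc m)) → Fin k} →
  ProperColoring (FC 2 (ℕ.suc (ℕ.suc m))) c → c zero ≢ c (fromℕ (ℕ.suc m))
FC₂-properColoring⇒ends≢ proper ends≡ =
  FC-properColoring⇒¬monochromatic ℕ.≤-refl proper FC₂-ends (pair-monochromatic ends≡)

≢∧≢⇒≡ : {x y z : Fin 2} → x ≢ y → y ≢ z → x ≡ z
≢∧≢⇒≡ {zero}     {zero}     x≢y _   = contradiction refl x≢y
≢∧≢⇒≡ {suc zero} {suc zero} x≢y _   = contradiction refl x≢y
≢∧≢⇒≡ {_}        {zero}     {zero}     _ y≢z = contradiction refl y≢z
≢∧≢⇒≡ {_}        {suc zero} {suc zero} _ y≢z = contradiction refl y≢z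
≢∧≢⇒≡ {zero}     {suc zero} {zero}     _ _   = refl
≢∧≢⇒≡ {suc zero} {zero}     {suc zero} _ _   = refl

-- Two steps along an alternating 2-colouring return to the same colour, so the path can be
-- shortened by two vertices.
alternating₂-ends≢⇒even : (c : Fin (ℕ.suc m) → Fin 2) → Alternating c → c zero ≢ c (fromℕ m) → 2 ∣ ℕ.suc m
alternating₂-ends≢⇒even {ℕ.zero}          c alt ends≢ = contradiction refl ends≢
alternating₂-ends≢⇒even {ℕ.suc ℕ.zero}    c alt ends≢ = ∣-refl
alternating₂-ends≢⇒even {ℕ.suc (ℕ.suc m)} c alt ends≢ =
  ∣m∣n⇒∣m+n ∣-refl (alternating₂-ends≢⇒even c′ (alt ∘ inject₁-consecutive ∘ inject₁-consecutive)
                                           (λ ends≡ → ends≢ (trans ends≡ last′≡last)))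
  where
  c′ : Fin (ℕ.suc m) → Fin 2
  c′ = c ∘ inject₁ ∘ inject₁
  last′≡last : c′ (fromℕ m) ≡ c (fromℕ (ℕ.suc (ℕ.suc m)))
  last′≡last = ≢∧≢⇒≡ (alt (inject₁-suc-consecutive (inject₁ (fromℕ m))))
                     (alt (inject₁-suc-consecutive (suc (fromℕ m))))

colorable-mono : {H : Hypergraph n} → k ≤ l → Colorable H k → Colorable H l
colorable-mono k≤l (c , proper) = (λ x → inject≤ (c x) k≤l) , λ e He 2≤∣e∣ →
  let x , y , x∈ , y∈ , cx≢cy = proper e He 2≤∣e∣
  in x , y , x∈ , y∈ , cx≢cy ∘ inject≤-injective k≤l k≤l (c x) (c y)

chromaticNumber-suc : {H : Hypergraph n} → Colorable H (ℕ.suc k) → ¬ Colorable H k →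
  ChromaticNumberIs H (ℕ.suc k)
chromaticNumber-suc colorable ¬colorable =
  colorable , λ l l<1+k → ¬colorable ∘ colorable-mono (ℕ.s≤s⁻¹ l<1+k)

initialSegment : ℕ → (n : ℕ) → Subset n
initialSegment ℕ.zero    n           = ⊥
initialSegment (ℕ.suc d) ℕ.zero      = []
initialSegment (ℕ.suc d) (ℕ.suc n)   = true ∷ initialSegment d n

∣initialSegment∣ : d ≤ n → ∣ initialSegment d n ∣ ≡ d
∣initialSegment∣ {ℕ.zero}  {n}       _           = ∣⊥∣≡0 n
∣initialSegment∣ {ℕ.suc d} {ℕ.suc n} (ℕ.s≤s d≤n) = cong ℕ.suc (∣initialSegment∣ d≤n)

initialSegment-downClosed : y ∈ initialSegment d n → x < y → x ∈ initialSegment d n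
initialSegment-downClosed {d = ℕ.zero}  y∈ _ = contradiction y∈ ∉⊥
initialSegment-downClosed {y = suc y} {d = ℕ.suc d} {x = zero}  _          _   = here
initialSegment-downClosed {y = suc y} {d = ℕ.suc d} {x = suc x} (there y∈) x<y =
  there (initialSegment-downClosed {d = d} y∈ (ℕ.s≤s⁻¹ x<y))

initialSegment-edge : d ≤ n → FC d n (initialSegment d n)
initialSegment-edge {d = d} d≤n =
  ∣initialSegment∣ d≤n , downClosed⇒GaleEvenness (initialSegment-downClosed {d = d})

FC-¬colorable₁ : 2 ≤ d → d ≤ n → ¬ Colorable (FC d n) 1
FC-¬colorable₁ 2≤d d≤n (c , proper) =
  FC-properColoring⇒¬monochromatic 2≤d proper (initialSegment-edge d≤n) constant
  where
  constant : Monochromatic c _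
  constant {x} {y} _ _ with c x | c y
  ... | zero | zero = refl

parity : ℕ → Fin 2
parity ℕ.zero            = zero
parity (ℕ.suc ℕ.zero)    = suc zero
parity (ℕ.suc (ℕ.suc n)) = parity n

parity-suc : ∀ n → parity (ℕ.suc n) ≢ parity n
parity-suc ℕ.zero            ()
parity-suc (ℕ.suc ℕ.zero)    ()
parity-suc (ℕ.suc (ℕ.suc n)) = parity-suc n

parity-even : ∀ q → parity (q ℕ.* 2) ≡ zero
parity-even ℕ.zero    = refl
parity-even (ℕ.suc q) = parity-even q

parityColoring : Fin n → Fin 2
parityColoring x = parity (toℕ x)

parityColoring-alternating : Alternating (parityColoring {n})
parityColoring-alternating {x = x} x→y cx≡cy = parity-suc (toℕ x) (trans (cong parity x→y) (sym cx≡cy))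

parityColoring-ends≢ : 2 ∣ ℕ.suc m → parityColoring {ℕ.suc m} zero ≢ parityColoring (fromℕ m)
parityColoring-ends≢ {m} (divides q 1+m≡2q) ends≡ = parity-suc m (begin
  parity (ℕ.suc m)          ≡⟨ cong parity 1+m≡2q ⟩
  parity (q ℕ.* 2)          ≡⟨ parity-even q ⟩
  zero                      ≡⟨ ends≡ ⟩
  parity (toℕ (fromℕ m))    ≡⟨ cong parity (toℕ-fromℕ m) ⟩
  parity m                  ∎)
  where open ≡-Reasoning

recolourLast : (Fin (ℕ.suc m) → Fin k) → Fin (ℕ.suc m) → Fin (ℕ.suc k)
recolourLast {k = k} c x with view x
... | ‵fromℕ     = fromℕ k
... | ‵inject₁ _ = inject₁ (c x)

recolourLast-alternating : {c : Fin (ℕ.suc m) → Fin k} → Alternating c → Alternating (recolourLast c)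
recolourLast-alternating alt {x} {y} x→y with view x | view y
... | ‵fromℕ     | _          = contradiction (ℕ.≤-reflexive x→y) fromℕ≮
... | ‵inject₁ _ | ‵fromℕ     = fromℕ≢inject₁ ∘ sym
... | ‵inject₁ _ | ‵inject₁ _ = alt x→y ∘ inject₁-injective

recolourLast-ends≢ : (c : Fin (ℕ.suc (ℕ.suc m)) → Fin k) →
  recolourLast c zero ≢ recolourLast c (fromℕ (ℕ.suc m))
recolourLast-ends≢ {m = m} c rewrite view-fromℕ (ℕ.suc m) = fromℕ≢inject₁ ∘ sym

FC₂-odd-chromaticNumber : ¬ 2 ∣ ℕ.suc (ℕ.suc m) → ChromaticNumberIs (FC 2 (ℕ.suc (ℕ.suc m))) 3
FC₂-odd-chromaticNumber {m = m} odd = chromaticNumber-suc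
  (recolourLast parityColoring , cycleColoring⇒properColoring₂
     (recolourLast-alternating parityColoring-alternating) (recolourLast-ends≢ {m = m} parityColoring))
  λ (c , proper) → odd (alternating₂-ends≢⇒even c (FC₂-properColoring⇒alternating proper)
                                                  (FC₂-properColoring⇒ends≢ proper))

FC₂-even-chromaticNumber : 2 ∣ ℕ.suc (ℕ.suc m) → ChromaticNumberIs (FC 2 (ℕ.suc (ℕ.suc m))) 2
FC₂-even-chromaticNumber even = chromaticNumber-suc
  (parityColoring , cycleColoring⇒properColoring₂ parityColoring-alternating (parityColoring-ends≢ even))
  (FC-¬colorable₁ ℕ.≤-refl (ℕ.s≤s (ℕ.s≤s ℕ.z≤n)))

FC-chromaticNumber : 3 ≤ d → d ℕ.< n → ChromaticNumberIs (FC d n) 2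
FC-chromaticNumber {n = ℕ.suc m} 3≤d d<n = chromaticNumber-suc
  (parityColoring , alternating⇒properColoring 3≤d parityColoring-alternating)
  (FC-¬colorable₁ (ℕ.≤-trans (ℕ.n≤1+n 2) 3≤d) (ℕ.<⇒≤ d<n))

proposition2p1 :
    ((n : ℕ) → 3 ≤ n →
      ((¬ (2 ∣ n) → ChromaticNumberIs (FC 2 n) 3) ×
       (2 ∣ n → ChromaticNumberIs (FC 2 n) 2)))
    ×
    ((d n : ℕ) → 3 ≤ d → d + 1 ≤ n → ChromaticNumberIs (FC d n) 2)
proposition2p1 =
  (λ { _ (ℕ.s≤s (ℕ.s≤s _)) → FC₂-odd-chromaticNumber , FC₂-even-chromaticNumber }) ,
  λ d n 3≤d d+1≤n → FC-chromaticNumber 3≤d (subst (_≤ n) (ℕ.+-comm d 1) d+1≤n)
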